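{- For every tournament $T$ and every integer $t \ge 1$ with $\vec{\omega}(T) \ge t$, we have $|V(T)| \ge \binom{t+1}{2}$.
   Context: A tournament is a finite directed graph $T$ such that for each pair of distinct vertices $u,w$ exactly one of $(u,w)$, $(w,u)$ is an arc. For a linear order $\ll$ on $V(T)$, the backedge graph $T^{\ll}$ is the undirected graph with vertex set $V(T)$ in which $\{u,w\}$ is an edge if and only if $(u,w)$ is an arc of $T$ and $w \ll u$. The directed clique number is $\vec{\omega}(T) = \min_{\ll} \omega(T^{\ll})$, the minimum over all linear orders $\ll$ on $V(T)$ of the clique number of the backedge graph. -}

module Defs where

open import Data.Nat using (ℕ; _≤_)
open import Data.Fin using (Fin; _<_)
open import Data.Fin.Permutation using (Permutation′; _⟨$⟩ʳ_)
open import Data.Product using (_×_; Σ)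
open import Data.Sum using (_⊎_)
open import Data.Empty using (⊥)
open import Relation.Nullary using (¬_)
open import Relation.Binary.PropositionalEquality using (_≡_; _≢_)
open import Function.Definitions using (Injective)

record Tournament (n : ℕ) : Set₁ where
  field
    Arc      : Fin n → Fin n → Set
    irrefl   : ∀ u → ¬ Arc u u
    total    : ∀ u w → u ≢ w → Arc u w ⊎ Arc w u
    asym     : ∀ u w → Arc u w → ¬ Arc w u

open Tournament public

-- A linear order ≪ on Fin n, given by a position bijection:
-- w ≪ u  iff  pos(w) < pos(u).
LinearOrder : ℕ → Set
LinearOrder n = Permutation′ n

_≪[_]_ : ∀ {n} → Fin n → LinearOrder n → Fin n → Set
w ≪[ π ] u = (π ⟨$⟩ʳ w) < (π ⟨$⟩ʳ u)

Graph : ℕ → Set₁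
Graph n = Fin n → Fin n → Set

Backedge : ∀ {n} → Tournament n → LinearOrder n → Graph n
Backedge T π u w = (Arc T u w × (w ≪[ π ] u)) ⊎ (Arc T w u × (u ≪[ π ] w))

HasClique : ∀ {n} → Graph n → ℕ → Set
HasClique {n} G k =
  Σ (Fin k → Fin n) λ f → Injective _≡_ _≡_ f × (∀ i j → i ≢ j → G (f i) (f j))

IsCliqueNumber : ∀ {n} → Graph n → ℕ → Set
IsCliqueNumber G k = HasClique G k × (∀ m → HasClique G m → m ≤ k)

IsDirCliqueNumber : ∀ {n} → Tournament n → ℕ → Set
IsDirCliqueNumber {n} T k =
  (Σ (LinearOrder n) λ π → IsCliqueNumber (Backedge T π) k)
  × (∀ (π : LinearOrder n) (m : ℕ) → IsCliqueNumber (Backedge T π) m → k ≤ m)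

{-# OPTIONS --safe #-}
-- Represent linear orders by injective ranks r : Fin n → ℕ (w before u iff r w < r u).
-- Say that S forces t if every ranking has a backedge t-clique inside S. If S forces t + 1,
-- take a backedge (t+1)-clique K for the natural order of Fin n. For any ranking r of the
-- other vertices, rank K first, in reversed order, and then the rest according to r: now no
-- two vertices of K form a backedge, so a backedge (t+1)-clique meets K at most once and the
-- rest of it is a backedge t-clique of r in S ∖ K. Hence S ∖ K forces t, and by induction
-- a set forcing t has at least t + (t − 1) + ⋯ + 1 = (t + 1) C 2 elements.
module Submission where

open import Defs
open import Data.Nat using (ℕ; _≤_; _+_)
open import Data.Nat.Combinatorics using (_C_)

open import Level using (0ℓ)
open import Data.Bool using (if_then_else_)
open import Data.Bool.Properties using (T-≡)
open import Data.Nat using (zero; suc; _∸_; _<_; _<?_; _<ᵇ_; s≤s)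
open import Data.Nat.Properties
  using (<ᵇ⇒<; <⇒<ᵇ; <-irrefl; <-asym; <-trans; <-cmp; <⇒≢; <⇒≱; ≰⇒>; ≤-trans; ≤∧≢⇒<;
         m<1+n⇒m≤n; m≤m+n; m∸n≤m; ∸-monoʳ-≤; ∸-cancelˡ-≡; +-cancelˡ-≡; +-cancelˡ-<; +-comm; 1+n≰n)
open import Data.Nat.Combinatorics using (nC1≡n; nCk+nC[k+1]≡[n+1]C[k+1])
open import Data.Fin using (Fin; toℕ; fromℕ<; inject₁; inject≤; punchIn; punchOut; splitAt; join)
open import Data.Fin.Properties
  using (_≟_; any?; all?; injective⇒≤; toℕ-injective; toℕ-fromℕ<; toℕ≤n; inject₁-injective;
         inject≤-injective; punchIn-injective; punchInᵢ≢i; punchOut-injective; join-splitAt)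
open import Data.Fin.Subset using (Subset; ∣_∣) renaming (_∈_ to _∈ₛ_)
open import Data.Fin.Subset.Properties using (p⊂q⇒∣p∣<∣q∣; ⊆⊤; ∈⊤; ∣⊤∣≡n)
open import Data.Fin.Permutation using (permutation; _⟨$⟩ʳ_)
open import Data.Vec using (tabulate)
open import Data.Vec.Properties using (lookup∘tabulate; []=⇒lookup; lookup⇒[]=)
open import Data.Vec.Functional using (Vector; []; _∷_; head; tail; _++_)
open import Data.Vec.Functional.Properties using (∷-cong)
open import Data.Vec.Functional.Relation.Unary.All using (All)
open import Data.Vec.Functional.Relation.Unary.All.Properties using (++⁺)
open import Data.Product using (Σ; ∃; _×_; _,_; proj₁; proj₂)
import Data.Product as Product
open import Data.Sum using (_⊎_; inj₁; inj₂; [_,_]′)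
import Data.Sum as Sum
open import Relation.Nullary using (¬_; Dec; yes; no; does; contradiction; ¬?)
open import Relation.Nullary.Decidable using (map′; _×-dec_; _⊎-dec_; _→-dec_; dec-true; dec-false)
open import Relation.Unary using (Pred; Decidable; U; _∖_)
open import Relation.Binary using (Rel; Asymmetric; tri<; tri≈; tri>)
open import Relation.Binary.PropositionalEquality
open import Function using (_∘_; _on_; flip; Equivalence)
open import Function.Definitions using (Injective)

injective⇒surjective : ∀ {n} {f : Fin n → Fin n} → Injective _≡_ _≡_ f → ∀ y → ∃ λ x → f x ≡ y
injective⇒surjective {suc n} {f} f-inj y with any? (λ x → f x ≟ y)
... | yes hit = hit
... | no miss = contradiction (injective⇒≤ skip-y-injective) 1+n≰n
  where
  skip-y : Fin (suc n) → Fin n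
  skip-y x = punchOut (λ y≡fx → miss (x , sym y≡fx))

  skip-y-injective : Injective _≡_ _≡_ skip-y
  skip-y-injective {a} {b} eq =
    f-inj (punchOut-injective (λ e → miss (a , sym e)) (λ e → miss (b , sym e)) eq)

permutationOfInjection : ∀ {n} (f : Fin n → Fin n) → Injective _≡_ _≡_ f → LinearOrder n
permutationOfInjection f f-inj = permutation f f⁻¹ (proj₂ ∘ surj) (λ x → f-inj (proj₂ (surj (f x))))
  where
  surj = injective⇒surjective f-inj
  f⁻¹ = proj₁ ∘ surj

++-injective : ∀ {a} {A : Set a} {m k} {xs : Vector A m} {ys : Vector A k} →
               Injective _≡_ _≡_ xs → Injective _≡_ _≡_ ys → (∀ i j → xs i ≢ ys j) →
               Injective _≡_ _≡_ (xs ++ ys)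
++-injective {m = m} {k} {xs} {ys} xs-inj ys-inj disjoint {i} {j} eq = begin
  i                      ≡⟨ join-splitAt m k i ⟨
  join m k (splitAt m i) ≡⟨ cong (join m k) (sides (splitAt m i) (splitAt m j) eq) ⟩
  join m k (splitAt m j) ≡⟨ join-splitAt m k j ⟩
  j                      ∎
  where
  open ≡-Reasoning
  sides : ∀ a b → [ xs , ys ]′ a ≡ [ xs , ys ]′ b → a ≡ b
  sides (inj₁ a) (inj₁ b) e = cong inj₁ (xs-inj e)
  sides (inj₁ a) (inj₂ b) e = contradiction e (disjoint a b)
  sides (inj₂ a) (inj₁ b) e = contradiction (sym e) (disjoint b a)
  sides (inj₂ a) (inj₂ b) e = cong inj₂ (ys-inj e)

any-Vector? : ∀ {p n} m {P : Pred (Vector (Fin n) m) p} →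
              (∀ {xs ys} → xs ≗ ys → P xs → P ys) → Decidable P → Dec (∃ P)
any-Vector? zero    resp P? = map′ ([] ,_) (λ (xs , p) → resp (λ ()) p) (P? [])
any-Vector? (suc m) resp P? =
  map′ (λ (x , xs , p) → x ∷ xs , p)
       (λ (xs , p) → head xs , tail xs , resp (∷-cong refl (λ _ → refl)) p)
       (any? λ x → any-Vector? m (resp ∘ ∷-cong refl) (P? ∘ (x ∷_)))

bounded-maximum : ∀ {p} {P : Pred ℕ p} → Decidable P → P 0 → ∀ b → (∀ m → P m → m ≤ b) →
                  ∃ λ k → P k × (∀ m → P m → m ≤ k)
bounded-maximum P? p0 zero    bound = 0 , p0 , bound
bounded-maximum P? p0 (suc b) bound with P? (suc b)
... | yes pb = suc b , pb , bound
... | no ¬pb = bounded-maximum P? p0 b λ m pm →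
  m<1+n⇒m≤n (≤∧≢⇒< (bound m pm) λ { refl → ¬pb pm })

module _ {n : ℕ} where

  IsClique : Graph n → ∀ {k} → Vector (Fin n) k → Set
  IsClique G f = ∀ i j → i ≢ j → G (f i) (f j)

  record CliqueIn (S : Pred (Fin n) 0ℓ) (G : Graph n) (k : ℕ) : Set where
    constructor cliqueIn
    field
      vertices  : Vector (Fin n) k
      injective : Injective _≡_ _≡_ vertices
      inside    : All S vertices
      adjacent  : IsClique G vertices

  AtLeast : ℕ → Pred (Fin n) 0ℓ → Set
  AtLeast m S = Σ (Vector (Fin n) m) λ f → Injective _≡_ _≡_ f × All S f

  HasClique⇒CliqueIn : ∀ {G k} → HasClique G k → CliqueIn U G k
  HasClique⇒CliqueIn (f , f-inj , f-clique) = cliqueIn f f-inj _ f-clique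

  CliqueIn-restrict : ∀ {S G k m} (e : Fin m → Fin k) → Injective _≡_ _≡_ e →
                      CliqueIn S G k → CliqueIn S G m
  CliqueIn-restrict e e-inj (cliqueIn f f-inj f∈S f-clique) =
    cliqueIn (f ∘ e) (e-inj ∘ f-inj) (f∈S ∘ e) λ i j i≢j → f-clique (e i) (e j) (i≢j ∘ e-inj)

  CliqueIn-map : ∀ {S G H k} → (∀ {u w} → S u → S w → G u w → H u w) →
                 CliqueIn S G k → CliqueIn S H k
  CliqueIn-map G⇒H (cliqueIn f f-inj f∈S f-clique) =
    cliqueIn f f-inj f∈S λ i j i≢j → G⇒H (f∈S i) (f∈S j) (f-clique i j i≢j)

  -- A clique has at most one vertex in an independent set.
  CliqueIn-avoid : ∀ {S K G t} → Decidable K → (∀ {u w} → K u → K w → u ≢ w → ¬ G u w) →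
                   CliqueIn S G (suc t) → CliqueIn (S ∖ K) G t
  CliqueIn-avoid {S} {K} {G} {t} K? independent clique@(cliqueIn f f-inj _ f-clique) =
    let e , e-inj , avoids = dropped
        cliqueIn g g-inj g∈S g-clique = CliqueIn-restrict e e-inj clique
    in cliqueIn g g-inj (λ j → g∈S j , avoids j) g-clique
    where
    dropped : Σ (Fin t → Fin (suc t)) λ e → Injective _≡_ _≡_ e × (∀ j → ¬ K (f (e j)))
    dropped with any? (K? ∘ f)
    ... | yes (i , fi∈K) = punchIn i , punchIn-injective i _ _ , λ j fj∈K →
      independent fi∈K fj∈K (punchInᵢ≢i i j ∘ sym ∘ f-inj)
                  (f-clique i (punchIn i j) (punchInᵢ≢i i j ∘ sym))
    ... | no none = inject₁ , inject₁-injective , λ j fj∈K → none (inject₁ j , fj∈K)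

  injective? : ∀ {k} (f : Vector (Fin n) k) → Dec (Injective _≡_ _≡_ f)
  injective? f = map′ (λ inj {i} {j} → inj i j) (λ inj i j → inj)
                      (all? λ i → all? λ j → (f i ≟ f j) →-dec (i ≟ j))

  isClique? : ∀ {G} → (∀ u w → Dec (G u w)) → ∀ {k} (f : Vector (Fin n) k) → Dec (IsClique G f)
  isClique? G? f = all? λ i → all? λ j → ¬? (i ≟ j) →-dec G? (f i) (f j)

  hasClique? : ∀ {G} → (∀ u w → Dec (G u w)) → ∀ k → Dec (HasClique G k)
  hasClique? {G} G? k = any-Vector? k respects λ f → injective? f ×-dec isClique? G? f
    where
    respects : ∀ {xs ys} → xs ≗ ys → Injective _≡_ _≡_ xs × IsClique G xs →
               Injective _≡_ _≡_ ys × IsClique G ys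
    respects xs≗ys (xs-inj , xs-clique) =
      (λ {i} {j} e → xs-inj (trans (xs≗ys i) (trans e (sym (xs≗ys j))))) ,
      λ i j i≢j → subst₂ G (xs≗ys i) (xs≗ys j) (xs-clique i j i≢j)

  cliqueNumber : ∀ {G} → (∀ u w → Dec (G u w)) → ∃ (IsCliqueNumber G)
  cliqueNumber G? = bounded-maximum (hasClique? G?) ((λ ()) , (λ { {()} }) , (λ ())) n
                                    λ m (f , f-inj , _) → injective⇒≤ f-inj

module RankOrder {n} (r : Fin n → ℕ) (r-inj : Injective _≡_ _≡_ r) where

  below : Fin n → Subset n
  below x = tabulate λ y → r y <ᵇ r x

  ∈-below⁺ : ∀ {x y} → r y < r x → y ∈ₛ below x
  ∈-below⁺ {x} {y} ry<rx =
    lookup⇒[]= y (below x) (trans (lookup∘tabulate _ y) (Equivalence.to T-≡ (<⇒<ᵇ ry<rx)))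

  ∈-below⁻ : ∀ {x y} → y ∈ₛ below x → r y < r x
  ∈-below⁻ {x} {y} y∈ =
    <ᵇ⇒< (r y) (r x) (Equivalence.from T-≡ (trans (sym (lookup∘tabulate _ y)) ([]=⇒lookup y∈)))

  ∉-below : ∀ x → ¬ x ∈ₛ below x
  ∉-below x x∈ = <-irrefl refl (∈-below⁻ x∈)

  position : Fin n → ℕ
  position x = ∣ below x ∣

  position<n : ∀ x → position x < n
  position<n x = subst (position x <_) (∣⊤∣≡n n) (p⊂q⇒∣p∣<∣q∣ (⊆⊤ , x , ∈⊤ , ∉-below x))

  position-mono : ∀ {x y} → r x < r y → position x < position y
  position-mono {x} rx<ry =
    p⊂q⇒∣p∣<∣q∣ ((λ z∈ → ∈-below⁺ (<-trans (∈-below⁻ z∈) rx<ry)) , x , ∈-below⁺ rx<ry , ∉-below x)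

  position-injective : Injective _≡_ _≡_ position
  position-injective {x} {y} eq with <-cmp (r x) (r y)
  ... | tri< rx<ry _ _ = contradiction eq (<⇒≢ (position-mono rx<ry))
  ... | tri≈ _ rx≡ry _ = r-inj rx≡ry
  ... | tri> _ _ ry<rx = contradiction (sym eq) (<⇒≢ (position-mono ry<rx))

  position-reflects : ∀ {x y} → position x < position y → r x < r y
  position-reflects {x} {y} lt with <-cmp (r x) (r y)
  ... | tri< rx<ry _ _ = rx<ry
  ... | tri≈ _ rx≡ry _ = contradiction (cong position (r-inj rx≡ry)) (<⇒≢ lt)
  ... | tri> _ _ ry<rx = contradiction (position-mono ry<rx) (<-asym lt)

  π : LinearOrder n
  π = permutationOfInjection (λ x → fromℕ< (position<n x))
        (position-injective ∘ subst₂ _≡_ (toℕ-fromℕ< _) (toℕ-fromℕ< _) ∘ cong toℕ)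

  π-reflects : ∀ {x y} → x ≪[ π ] y → r x < r y
  π-reflects = position-reflects ∘ subst₂ _<_ (toℕ-fromℕ< _) (toℕ-fromℕ< _)

module OrdinalSum {n} {K : Pred (Fin n) 0ℓ} (K? : Decidable K) (a b : Fin n → ℕ)
                  {N} (a<N : ∀ x → a x < N) where

  rank : Fin n → ℕ
  rank x = if does (K? x) then a x else N + b x

  rank-inside : ∀ {x} → K x → rank x ≡ a x
  rank-inside {x} x∈K = cong (λ c → if c then a x else N + b x) (dec-true (K? x) x∈K)

  rank-outside : ∀ {x} → ¬ K x → rank x ≡ N + b x
  rank-outside {x} x∉K = cong (λ c → if c then a x else N + b x) (dec-false (K? x) x∉K)

  a<N+b : ∀ x y → a x < N + b y
  a<N+b x y = ≤-trans (a<N x) (m≤m+n N (b y))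

  rank-injective : Injective _≡_ _≡_ a → Injective _≡_ _≡_ b → Injective _≡_ _≡_ rank
  rank-injective a-inj b-inj {x} {y} eq with K? x | K? y
  ... | yes _ | yes _ = a-inj eq
  ... | yes _ | no _  = contradiction eq (<⇒≢ (a<N+b x y))
  ... | no _  | yes _ = contradiction (sym eq) (<⇒≢ (a<N+b y x))
  ... | no _  | no _  = b-inj (+-cancelˡ-≡ N _ _ eq)

  rank-inside-< : ∀ {x y} → K x → K y → rank x < rank y → a x < a y
  rank-inside-< x∈K y∈K = subst₂ _<_ (rank-inside x∈K) (rank-inside y∈K)

  rank-outside-< : ∀ {x y} → ¬ K x → ¬ K y → rank x < rank y → b x < b y
  rank-outside-< x∉K y∉K = +-cancelˡ-< N _ _ ∘ subst₂ _<_ (rank-outside x∉K) (rank-outside y∉K)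

reversed : ∀ n → Fin n → ℕ
reversed n x = n ∸ toℕ x

reversed<1+n : ∀ {n} x → reversed n x < suc n
reversed<1+n {n} x = s≤s (m∸n≤m n (toℕ x))

reversed-injective : ∀ {n} → Injective _≡_ _≡_ (reversed n)
reversed-injective {x = x} {y} = toℕ-injective ∘ ∸-cancelˡ-≡ (toℕ≤n x) (toℕ≤n y)

reversed-reverses : ∀ {n x y} → reversed n x < reversed n y → toℕ y < toℕ x
reversed-reverses {n} lt = ≰⇒> λ x≤y → <⇒≱ lt (∸-monoʳ-≤ n x≤y)

[1+n]C2≡n+nC2 : ∀ n → suc n C 2 ≡ n + n C 2
[1+n]C2≡n+nC2 n = begin
  suc n C 2         ≡⟨ nCk+nC[k+1]≡[n+1]C[k+1] n 1 ⟨
  n C 1 + n C 2     ≡⟨ cong (_+ n C 2) (nC1≡n n) ⟩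
  n + n C 2         ∎
  where open ≡-Reasoning

module _ {n} (T : Tournament n) where

  Arc? : ∀ u w → Dec (Arc T u w)
  Arc? u w with u ≟ w
  ... | yes refl = no (irrefl T u)
  ... | no u≢w with total T u w u≢w
  ...   | inj₁ uw = yes uw
  ...   | inj₂ wu = no (asym T w u wu)

  -- Backedge T π is definitionally BackedgeBy (λ w u → w ≪[ π ] u); rankings use _<_ on r.
  BackedgeBy : Rel (Fin n) 0ℓ → Graph n
  BackedgeBy _≺_ u w = (Arc T u w × w ≺ u) ⊎ (Arc T w u × u ≺ w)

  BackedgeBy? : ∀ {_≺_} → (∀ u w → Dec (u ≺ w)) → ∀ u w → Dec (BackedgeBy _≺_ u w)
  BackedgeBy? ≺? u w = (Arc? u w ×-dec ≺? w u) ⊎-dec (Arc? w u ×-dec ≺? u w)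

  BackedgeBy-map : ∀ {_≺_ _≺′_ : Rel (Fin n) 0ℓ} {u w} → (w ≺ u → w ≺′ u) → (u ≺ w → u ≺′ w) →
                   BackedgeBy _≺_ u w → BackedgeBy _≺′_ u w
  BackedgeBy-map f g = Sum.map (Product.map₂ f) (Product.map₂ g)

  BackedgeBy-flip : ∀ {_≺_ : Rel (Fin n) 0ℓ} {u w} → Asymmetric _≺_ →
                    BackedgeBy _≺_ u w → ¬ BackedgeBy (flip _≺_) u w
  BackedgeBy-flip ≺-asym (inj₁ (_  , w≺u)) (inj₁ (_  , u≺w)) = ≺-asym w≺u u≺w
  BackedgeBy-flip ≺-asym (inj₁ (uw , _))   (inj₂ (wu , _))   = asym T _ _ uw wu
  BackedgeBy-flip ≺-asym (inj₂ (wu , _))   (inj₁ (uw , _))   = asym T _ _ uw wu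
  BackedgeBy-flip ≺-asym (inj₂ (_  , u≺w)) (inj₂ (_  , w≺u)) = ≺-asym u≺w w≺u

  backedgeClique : ∀ {k} → IsDirCliqueNumber T k → ∀ π → CliqueIn U (Backedge T π) k
  backedgeClique {k} (_ , minimal) π =
    let m , ω = cliqueNumber (BackedgeBy? λ u w → toℕ (π ⟨$⟩ʳ u) <? toℕ (π ⟨$⟩ʳ w))
        k≤m = minimal π m ω
    in CliqueIn-restrict (λ i → inject≤ i k≤m) (inject≤-injective k≤m k≤m _ _)
                         (HasClique⇒CliqueIn (proj₁ ω))

  BackCliqueForced : Pred (Fin n) 0ℓ → ℕ → Set
  BackCliqueForced S t = ∀ r → Injective _≡_ _≡_ r → CliqueIn S (BackedgeBy (_<_ on r)) t

  Image : ∀ {k} → Vector (Fin n) k → Pred (Fin n) 0ℓ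
  Image g x = ∃ λ i → g i ≡ x

  BackCliqueForced-peel : ∀ {S t} → BackCliqueForced S (suc t) →
    Σ (Vector (Fin n) (suc t)) λ g → Injective _≡_ _≡_ g × All S g × BackCliqueForced (S ∖ Image g) t
  BackCliqueForced-peel {S} {t} forced = g , g-inj , g∈S , forced′
    where
    open CliqueIn (forced toℕ toℕ-injective)
      renaming (vertices to g; injective to g-inj; inside to g∈S; adjacent to g-clique)

    image? : Decidable (Image g)
    image? x = any? λ i → g i ≟ x

    forced′ : BackCliqueForced (S ∖ Image g) t
    forced′ r r-inj =
      CliqueIn-map (λ (_ , u∉K) (_ , w∉K) → BackedgeBy-map {_<_ on rank} {_<_ on r}
                                                (rank-outside-< w∉K u∉K) (rank-outside-< u∉K w∉K))
        (CliqueIn-avoid image? independent (forced rank (rank-injective reversed-injective r-inj)))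
      where
      open OrdinalSum image? (reversed n) r reversed<1+n
      independent : ∀ {u w} → Image g u → Image g w → u ≢ w → ¬ BackedgeBy (_<_ on rank) u w
      independent (i , refl) (j , refl) gi≢gj =
        BackedgeBy-flip {_<_ on toℕ} <-asym (g-clique i j (gi≢gj ∘ cong g)) ∘
        BackedgeBy-map {_<_ on rank} {flip (_<_ on toℕ)}
          (reversed-reverses ∘ rank-inside-< (j , refl) (i , refl))
          (reversed-reverses ∘ rank-inside-< (i , refl) (j , refl))

  BackCliqueForced⇒AtLeast : ∀ t {S} → BackCliqueForced S t → AtLeast (suc t C 2) S
  BackCliqueForced⇒AtLeast zero    _                = [] , (λ { {()} }) , λ ()
  BackCliqueForced⇒AtLeast (suc t) {S} forced
    with g , g-inj , g∈S , forced′ ← BackCliqueForced-peel forced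
    with h , h-inj , h∈S∖g ← BackCliqueForced⇒AtLeast t forced′ =
    subst (λ m → AtLeast m S) (sym ([1+n]C2≡n+nC2 (suc t)))
      ( g ++ h
      , ++-injective g-inj h-inj (λ i j gi≡hj → proj₂ (h∈S∖g j) (i , gi≡hj))
      , ++⁺ S g∈S (proj₁ ∘ h∈S∖g))

theorem2 : (n : ℕ) (T : Tournament n) (t k : ℕ) → 1 ≤ t → IsDirCliqueNumber T k → t ≤ k → (t + 1) C 2 ≤ n
-- The bound also holds for t = 0.
theorem2 n T t k _ ω⃗ t≤k =
  let _ , distinct , _ = BackCliqueForced⇒AtLeast T t forced
  in subst (_≤ n) (cong (_C 2) (+-comm 1 t)) (injective⇒≤ distinct)
  where
  forced : BackCliqueForced T U t
  forced r r-inj =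
    CliqueIn-map (λ _ _ → BackedgeBy-map T {λ w u → w ≪[ π ] u} {_<_ on r} π-reflects π-reflects)
                 (CliqueIn-restrict (λ i → inject≤ i t≤k) (inject≤-injective t≤k t≤k _ _)
                                    (backedgeClique T ω⃗ π))
    where open RankOrder r r-inj
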